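{- Let $v\in\mathcal{S}_d$ be any pattern. Then for every $n\in\mathbb{N}$ and every $r\in\mathbb{N}_0$, $$g_r^v(\mathcal{S}_n)=\sum_{k=1}^{n}(-1)^{n-k}\binom{n}{k}\,g_r^v([k]^n).$$
   Context: $[k]^n$ is the set of words of length $n$ with letters in $[k]=\{1,\dots,k\}$, and $\mathcal{S}_n\subseteq[n]^n$ is the set of permutations of $[n]$ written as words. For a word $u=u_1\cdots u_n$, a consecutive occurrence of $v$ is an index $j$, $1\le j\le n-d+1$, with $u_j\cdots u_{j+d-1}$ order-isomorphic to $v$ (for all $p,q$: $u_{j+p-1}<u_{j+q-1}\iff v_p<v_q$ and $u_{j+p-1}=u_{j+q-1}\iff v_p=v_q$); $\mathrm{con}_v(u)$ is the number of these. For a set of words $\mathcal{A}$, $g_r^v(\mathcal{A})=\#\{u\in\mathcal{A}:\mathrm{con}_v(u)=r\}$. -}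

module Defs where

open import Data.Nat using (ℕ; zero; suc; _+_; _∸_; _<ᵇ_; _≡ᵇ_; _≤_)
open import Data.Nat.Combinatorics using (_C_)
open import Data.Fin using (Fin; toℕ)
open import Data.Vec using (Vec; []; _∷_; lookup)
open import Data.List using (List; []; _∷_; map; concatMap; filterᵇ; length; allFin; upTo; foldr)
open import Data.Bool using (Bool; true; false; _∧_; if_then_else_)
open import Data.Integer using (ℤ; +_; -_; _*_) renaming (_+_ to _+ℤ_)
open import Function.Definitions using (Injective)
open import Relation.Binary.PropositionalEquality using (_≡_)
open import Data.Product using (Σ)

_⇔ᵇ_ : Bool → Bool → Bool
true  ⇔ᵇ b = b
false ⇔ᵇ true = false
false ⇔ᵇ false = true

-- all words of length n over an alphabet of size k; a letter i ∈ [k] is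
-- represented by Fin k (the letter toℕ i + 1)
words : (k n : ℕ) → List (Vec (Fin k) n)
words k zero    = [] ∷ []
words k (suc n) = concatMap (λ a → map (a ∷_) (words k n)) (allFin k)

allᵇ : {d : ℕ} → (Fin d → Bool) → Bool
allᵇ {d} f = foldr (λ i b → f i ∧ b) true (allFin d)

-- letter of u at position j + p (0-based), as a natural number; 0 if out of range
at : {k n : ℕ} → Vec (Fin k) n → ℕ → ℕ
at []       _       = 0
at (x ∷ u)  zero    = toℕ x
at (x ∷ u)  (suc m) = at u m

-- u_{j+1} ⋯ u_{j+d} (0-based start j) is order-isomorphic to v
occursAt : {d k n : ℕ} → Vec (Fin d) d → Vec (Fin k) n → ℕ → Bool
occursAt {d} v u j =
  allᵇ {d} λ p → allᵇ {d} λ q →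
    ((at u (j + toℕ p) <ᵇ at u (j + toℕ q)) ⇔ᵇ (toℕ (lookup v p) <ᵇ toℕ (lookup v q)))
    ∧ ((at u (j + toℕ p) ≡ᵇ at u (j + toℕ q)) ⇔ᵇ (toℕ (lookup v p) ≡ᵇ toℕ (lookup v q)))

-- con_v(u): number of 0-based starting positions j with 0 ≤ j ≤ n - d
-- (i.e. 1-based j with 1 ≤ j ≤ n-d+1) where an occurrence of v starts;
-- no positions when d > n
con : {d k n : ℕ} → Vec (Fin d) d → Vec (Fin k) n → ℕ
con {d} {k} {n} v u with d Data.Nat.≤ᵇ n
... | false = 0
... | true  = length (filterᵇ (occursAt v u) (upTo (suc (n ∸ d))))

isPermᵇ : {n : ℕ} → Vec (Fin n) n → Bool
isPermᵇ {n} u = allᵇ {n} λ p → allᵇ {n} λ q →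
  (toℕ (lookup u p) ≡ᵇ toℕ (lookup u q)) ⇔ᵇ (toℕ p ≡ᵇ toℕ q)

perms : (n : ℕ) → List (Vec (Fin n) n)
perms n = filterᵇ isPermᵇ (words n n)

g : {d k n : ℕ} → ℕ → Vec (Fin d) d → List (Vec (Fin k) n) → ℕ
g r v A = length (filterᵇ (λ u → con v u ≡ᵇ r) A)

IsPerm : {d : ℕ} → Vec (Fin d) d → Set
IsPerm {d} v = Injective _≡_ _≡_ (lookup v)

sign : ℕ → ℤ
sign zero = + 1
sign (suc m) = - sign m

sumFrom1 : ℕ → (ℕ → ℤ) → ℤ
sumFrom1 zero    f = + 0
sumFrom1 (suc n) f = sumFrom1 n f +ℤ f (suc n)

-- Let R j K count the words of [K]^n with con_v = r that contain each of the
-- letters 1, …, j. Splitting by whether the letter j+1 occurs gives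
-- R j (K+1) = R (j+1) (K+1) + R j K for j ≤ K: the words avoiding that letter are
-- exactly the images of [K]^n under the order embedding [K] → [K+1] that skips it,
-- and con_v is invariant under order embeddings of the alphabet. Iterating, R j (j+m)
-- is the j-th forward difference of K ↦ g_r^v([K]^n) at m, while R n n = g_r^v(𝒮_n)
-- because a word of [n]^n contains all n letters iff it is a permutation.

{-# OPTIONS --safe #-}
module Submission where

open import Defs
open import Data.Nat
  using (ℕ; zero; suc; _+_; _∸_; _≤_; _<_; _≡ᵇ_; _<ᵇ_; _≤ᵇ_; z≤n; s≤s; s≤s⁻¹; s<s⁻¹)
open import Data.Nat.Properties
  using ( ≡ᵇ⇒≡; ≡⇒≡ᵇ; <ᵇ-reflects-<; ≤ᵇ⇒≤; ≤-antisym; ≤-reflexive; <⇒≱; ≰⇒>; ≤-trans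
        ; n≤1+n; n<1+n; m<n⇒m<1+n; m<1+n⇒m<n∨m≡n; m≤m+n; +-∸-assoc; +-suc; +-identityʳ
        ; +-monoʳ-<; +-monoˡ-≤; m∸n+n≡m )
open import Data.Nat.Combinatorics using (_C_; nCk+nC[k+1]≡[n+1]C[k+1]; k>n⇒nCk≡0)
open import Data.Fin as Fin using (Fin; toℕ; punchIn; punchOut; fromℕ<)
open import Data.Fin.Properties
  using ( toℕ-fromℕ<; toℕ<n; toℕ-injective; 0≢1+n; suc-injective
        ; punchIn-mono-≤; punchIn-cancel-≤; punchOut-injective )
open import Data.Vec as Vec using (Vec; []; _∷_; lookup)
open import Data.Vec.Properties using (lookup-map)
open import Data.List
  using (List; []; _∷_; _++_; map; concatMap; filterᵇ; foldr; length; allFin; upTo; tabulate)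
open import Data.List.Properties
  using ( foldr-cong; filter-++; filter-all; filter-none; map-∘; map-tabulate
        ; map-concatMap; concatMap-map; concatMap-cong )
open import Data.List.Relation.Unary.All as All using (All; []; _∷_; universal)
open import Data.List.Membership.Propositional using (_∈_)
open import Data.List.Membership.Propositional.Properties using (∈-upTo⁻; ∈-allFin)
open import Data.List.Relation.Unary.Any using (here; there)
open import Data.Bool using (Bool; true; false; _∧_; not; T; T?)
open import Data.Bool.Properties using (∧-assoc; ∧-comm; ∧-identityʳ; T-∧)
open import Data.Integer using (ℤ; +_; -_; _*_; _-_) renaming (_+_ to _+ℤ_)
open import Data.Integer.Properties using (pos-+)
open import Data.Integer.Tactic.RingSolver using (solve-∀)
open import Data.Product as Product using (∃; _,_; proj₁; proj₂)
open import Function using (id; _∘_; _⇔_; mk⇔; Equivalence)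
open import Function.Definitions using (Injective; StrictlySurjective)
open import Function.Properties.Equivalence using () renaming (trans to ⇔-trans; sym to ⇔-sym)
open import Data.Empty using (⊥-elim)
open import Data.Unit using (tt)
open import Data.Sum using (_⊎_; inj₁; inj₂)
open import Relation.Nullary using (yes; no)
open import Relation.Nullary.Reflects using (Reflects; ofʸ; ofⁿ; fromEquivalence; T-reflects)
open import Relation.Binary.PropositionalEquality

count : {A : Set} → (A → Bool) → List A → ℕ
count p xs = length (filterᵇ p xs)

count-cong : {A : Set} {p q : A → Bool} (xs : List A) →
  (∀ x → x ∈ xs → p x ≡ q x) → count p xs ≡ count q xs
count-cong [] _ = refl
count-cong {p = p} {q} (x ∷ xs) p≗q with p x | q x | p≗q x (here refl)
... | true  | .true  | refl = cong suc (count-cong xs (λ y → p≗q y ∘ there))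
... | false | .false | refl = count-cong xs (λ y → p≗q y ∘ there)

count-split : {A : Set} (p q : A → Bool) (xs : List A) →
  count p xs ≡ count (λ x → p x ∧ not (q x)) xs + count (λ x → p x ∧ q x) xs
count-split p q [] = refl
count-split p q (x ∷ xs) with p x | q x
... | true  | false = cong suc (count-split p q xs)
... | true  | true  = trans (cong suc (count-split p q xs)) (sym (+-suc _ _))
... | false | _     = count-split p q xs

count-filterᵇ : {A : Set} (p q : A → Bool) (xs : List A) →
  count p (filterᵇ q xs) ≡ count (λ x → p x ∧ q x) xs
count-filterᵇ p q [] = refl
count-filterᵇ p q (x ∷ xs) with q x
... | false rewrite ∧-comm (p x) false = count-filterᵇ p q xs
... | true with p x
...   | true  = cong suc (count-filterᵇ p q xs)
...   | false = count-filterᵇ p q xs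

count-map : {A B : Set} (p : B → Bool) (f : A → B) (xs : List A) →
  count p (map f xs) ≡ count (p ∘ f) xs
count-map p f [] = refl
count-map p f (x ∷ xs) with p (f x)
... | true  = cong suc (count-map p f xs)
... | false = count-map p f xs

filterᵇ-map : {A B : Set} (p : B → Bool) (f : A → B) (xs : List A) →
  filterᵇ p (map f xs) ≡ map f (filterᵇ (p ∘ f) xs)
filterᵇ-map p f [] = refl
filterᵇ-map p f (x ∷ xs) with p (f x)
... | true  = cong (f x ∷_) (filterᵇ-map p f xs)
... | false = filterᵇ-map p f xs

-- Words avoiding a letter

-- Letters are numbered from 0 here: b stands for the letter b + 1 of [k].
avoids : {k n : ℕ} → ℕ → Vec (Fin k) n → Bool
avoids b []      = true
avoids b (x ∷ w) = not (toℕ x ≡ᵇ b) ∧ avoids b w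

allFin-without : (K : ℕ) (i : Fin (suc K)) →
  filterᵇ (λ a → not (toℕ a ≡ᵇ toℕ i)) (allFin (suc K)) ≡ map (punchIn i) (allFin K)
allFin-without K Fin.zero = begin
  filterᵇ (λ a → not (toℕ a ≡ᵇ 0)) (tabulate Fin.suc)
    ≡⟨ cong (filterᵇ _) (sym (map-tabulate (λ a → a) Fin.suc)) ⟩
  filterᵇ (λ a → not (toℕ a ≡ᵇ 0)) (map Fin.suc (allFin K))
    ≡⟨ filterᵇ-map _ Fin.suc (allFin K) ⟩
  map Fin.suc (filterᵇ (λ _ → true) (allFin K))
    ≡⟨ cong (map Fin.suc) (filter-all (T? ∘ (λ _ → true)) (universal _ (allFin K))) ⟩
  map Fin.suc (allFin K) ∎
  where open ≡-Reasoning
allFin-without (suc K) (Fin.suc i) = cong (Fin.zero ∷_) (begin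
  filterᵇ ne (tabulate Fin.suc)
    ≡⟨ cong (filterᵇ ne) (sym (map-tabulate (λ a → a) Fin.suc)) ⟩
  filterᵇ ne (map Fin.suc (allFin (suc K)))
    ≡⟨ filterᵇ-map ne Fin.suc (allFin (suc K)) ⟩
  map Fin.suc (filterᵇ (λ a → not (toℕ a ≡ᵇ toℕ i)) (allFin (suc K)))
    ≡⟨ cong (map Fin.suc) (allFin-without K i) ⟩
  map Fin.suc (map (punchIn i) (allFin K))
    ≡⟨ sym (map-∘ (allFin K)) ⟩
  map (punchIn (Fin.suc i) ∘ Fin.suc) (allFin K)
    ≡⟨ map-∘ (allFin K) ⟩
  map (punchIn (Fin.suc i)) (map Fin.suc (allFin K))
    ≡⟨ cong (map (punchIn (Fin.suc i))) (map-tabulate (λ a → a) Fin.suc) ⟩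
  map (punchIn (Fin.suc i)) (tabulate Fin.suc) ∎)
  where
  open ≡-Reasoning
  ne : Fin (suc (suc K)) → Bool
  ne a = not (toℕ a ≡ᵇ suc (toℕ i))

filterᵇ-avoids-blocks : {k n : ℕ} (b : ℕ) (W : List (Vec (Fin k) n)) (as : List (Fin k)) →
  filterᵇ (avoids b) (concatMap (λ a → map (a ∷_) W) as)
  ≡ concatMap (λ a → map (a ∷_) (filterᵇ (avoids b) W)) (filterᵇ (λ a → not (toℕ a ≡ᵇ b)) as)
filterᵇ-avoids-blocks b W [] = refl
filterᵇ-avoids-blocks b W (a ∷ as)
  rewrite filter-++ (T? ∘ avoids b) (map (a ∷_) W) (concatMap (λ a → map (a ∷_) W) as)
        | filterᵇ-map (avoids b) (a ∷_) W
  with toℕ a ≡ᵇ b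
... | true  = cong₂ _++_ (cong (map (a ∷_)) (filter-none (T? ∘ (λ _ → false)) (universal (λ _ ()) W)))
                         (filterᵇ-avoids-blocks b W as)
... | false = cong (map (a ∷_) (filterᵇ (avoids b) W) ++_) (filterᵇ-avoids-blocks b W as)

words-avoiding : (K n : ℕ) (i : Fin (suc K)) →
  filterᵇ (avoids (toℕ i)) (words (suc K) n) ≡ map (Vec.map (punchIn i)) (words K n)
words-avoiding K zero i = refl
words-avoiding K (suc n) i = begin
  filterᵇ (avoids (toℕ i)) (words (suc K) (suc n))
    ≡⟨ filterᵇ-avoids-blocks (toℕ i) (words (suc K) n) (allFin (suc K)) ⟩
  concatMap (λ a → map (a ∷_) (filterᵇ (avoids (toℕ i)) (words (suc K) n))) (filterᵇ ne (allFin (suc K)))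
    ≡⟨ cong₂ (λ ws as → concatMap (λ a → map (a ∷_) ws) as) (words-avoiding K n i) (allFin-without K i) ⟩
  concatMap (λ a → map (a ∷_) (map ι W)) (map (punchIn i) (allFin K))
    ≡⟨ concatMap-map (λ a → map (a ∷_) (map ι W)) (punchIn i) (allFin K) ⟩
  concatMap (λ y → map (punchIn i y ∷_) (map ι W)) (allFin K)
    ≡⟨ concatMap-cong (λ y → trans (sym (map-∘ W)) (map-∘ W)) (allFin K) ⟩
  concatMap (λ y → map ι (map (y ∷_) W)) (allFin K)
    ≡⟨ sym (map-concatMap ι (λ y → map (y ∷_) W) (allFin K)) ⟩
  map ι (words K (suc n)) ∎
  where
  open ≡-Reasoning
  ι : {m : ℕ} → Vec (Fin K) m → Vec (Fin (suc K)) m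
  ι = Vec.map (punchIn i)
  W : List (Vec (Fin K) n)
  W = words K n
  ne : Fin (suc K) → Bool
  ne a = not (toℕ a ≡ᵇ toℕ i)

reflects-⇔ : {A B : Set} {x y : Bool} → Reflects A x → Reflects B y → A ⇔ B → x ≡ y
reflects-⇔ (ofʸ _)  (ofʸ _)  _   = refl
reflects-⇔ (ofʸ a)  (ofⁿ ¬b) A⇔B = ⊥-elim (¬b (Equivalence.to A⇔B a))
reflects-⇔ (ofⁿ ¬a) (ofʸ b)  A⇔B = ⊥-elim (¬a (Equivalence.from A⇔B b))
reflects-⇔ (ofⁿ _)  (ofⁿ _)  _   = refl

≡ᵇ-reflects-≡ : (m n : ℕ) → Reflects (m ≡ n) (m ≡ᵇ n)
≡ᵇ-reflects-≡ m n = fromEquivalence (≡ᵇ⇒≡ m n) (≡⇒≡ᵇ m n)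

T-⇔ᵇ : {x y : Bool} → T (x ⇔ᵇ y) ⇔ x ≡ y
T-⇔ᵇ {true}  {true}  = mk⇔ (λ _ → refl) (λ _ → tt)
T-⇔ᵇ {true}  {false} = mk⇔ (λ ()) (λ ())
T-⇔ᵇ {false} {true}  = mk⇔ (λ ()) (λ ())
T-⇔ᵇ {false} {false} = mk⇔ (λ _ → refl) (λ _ → tt)

T-foldr-∧ : {A : Set} (p : A → Bool) (xs : List A) →
  T (foldr (λ i b → p i ∧ b) true xs) ⇔ All (T ∘ p) xs
T-foldr-∧ p []       = mk⇔ (λ _ → []) (λ _ → tt)
T-foldr-∧ p (x ∷ xs) = ⇔-trans T-∧ (mk⇔
  (Product.uncurry λ px pxs → px ∷ Equivalence.to (T-foldr-∧ p xs) pxs)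
  (λ { (px ∷ pxs) → px , Equivalence.from (T-foldr-∧ p xs) pxs }))

T-allᵇ : {d : ℕ} (p : Fin d → Bool) → T (allᵇ p) ⇔ (∀ i → T (p i))
T-allᵇ {d} p = ⇔-trans (T-foldr-∧ p (allFin d))
  (mk⇔ (λ all i → All.lookup all (∈-allFin i)) (λ all → universal all (allFin d)))

allᵇ-cong : {d : ℕ} {p q : Fin d → Bool} → (∀ i → p i ≡ q i) → allᵇ p ≡ allᵇ q
allᵇ-cong {d} p≗q = foldr-cong (λ i b → cong (_∧ b) (p≗q i)) refl (allFin d)

-- Order embeddings of the alphabet

IsOrderEmbedding : {k k′ : ℕ} → (Fin k → Fin k′) → Set
IsOrderEmbedding f = ∀ x y → x Fin.≤ y ⇔ f x Fin.≤ f y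

punchIn-isOrderEmbedding : {K : ℕ} (i : Fin (suc K)) → IsOrderEmbedding (punchIn i)
punchIn-isOrderEmbedding i x y = mk⇔ (punchIn-mono-≤ i x y) (punchIn-cancel-≤ i x y)

at-lookup : {k n m : ℕ} (u : Vec (Fin k) n) (m<n : m < n) → at u m ≡ toℕ (lookup u (fromℕ< m<n))
at-lookup {m = zero}  (x ∷ u) _   = refl
at-lookup {m = suc m} (x ∷ u) m<n = at-lookup u (s<s⁻¹ m<n)

module _ {k k′ : ℕ} {f : Fin k → Fin k′} (emb : IsOrderEmbedding f) where

  embedding-<ᵇ : (x y : Fin k) → (toℕ (f x) <ᵇ toℕ (f y)) ≡ (toℕ x <ᵇ toℕ y)
  embedding-<ᵇ x y = reflects-⇔ (<ᵇ-reflects-< _ _) (<ᵇ-reflects-< _ _) (mk⇔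
    (λ fx<fy → ≰⇒> λ y≤x → <⇒≱ fx<fy (Equivalence.to (emb y x) y≤x))
    (λ x<y → ≰⇒> λ fy≤fx → <⇒≱ x<y (Equivalence.from (emb y x) fy≤fx)))

  embedding-≡ᵇ : (x y : Fin k) → (toℕ (f x) ≡ᵇ toℕ (f y)) ≡ (toℕ x ≡ᵇ toℕ y)
  embedding-≡ᵇ x y = reflects-⇔ (≡ᵇ-reflects-≡ _ _) (≡ᵇ-reflects-≡ _ _) (mk⇔
    (λ fx≡fy → ≤-antisym (Equivalence.from (emb x y) (≤-reflexive fx≡fy))
                         (Equivalence.from (emb y x) (≤-reflexive (sym fx≡fy))))
    (λ x≡y → ≤-antisym (Equivalence.to (emb x y) (≤-reflexive x≡y))
                       (Equivalence.to (emb y x) (≤-reflexive (sym x≡y)))))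

  occursAt-map : {d n : ℕ} (v : Vec (Fin d) d) (u : Vec (Fin k) n) (j : ℕ) → j + d ≤ n →
    occursAt v (Vec.map f u) j ≡ occursAt v u j
  occursAt-map {d} {n} v u j j+d≤n = allᵇ-cong λ p → allᵇ-cong λ q →
    cong₂ (λ lt eq → (lt ⇔ᵇ (toℕ (lookup v p) <ᵇ toℕ (lookup v q)))
                   ∧ (eq ⇔ᵇ (toℕ (lookup v p) ≡ᵇ toℕ (lookup v q))))
      (compare _<ᵇ_ embedding-<ᵇ p q) (compare _≡ᵇ_ embedding-≡ᵇ p q)
    where
    inRange : (p : Fin d) → j + toℕ p < n
    inRange p = ≤-trans (+-monoʳ-< j (toℕ<n p)) j+d≤n
    compare : (_⊙_ : ℕ → ℕ → Bool) → (∀ x y → (toℕ (f x) ⊙ toℕ (f y)) ≡ (toℕ x ⊙ toℕ y)) →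
      (p q : Fin d) → (at (Vec.map f u) (j + toℕ p) ⊙ at (Vec.map f u) (j + toℕ q))
                    ≡ (at u (j + toℕ p) ⊙ at u (j + toℕ q))
    compare _⊙_ f-pres p q
      rewrite at-lookup (Vec.map f u) (inRange p) | at-lookup (Vec.map f u) (inRange q)
            | at-lookup u (inRange p) | at-lookup u (inRange q)
            | lookup-map (fromℕ< (inRange p)) f u | lookup-map (fromℕ< (inRange q)) f u
      = f-pres _ _

  con-map : {d n : ℕ} (v : Vec (Fin d) d) (u : Vec (Fin k) n) → con v (Vec.map f u) ≡ con v u
  con-map {d} {n} v u with d ≤ᵇ n in d≤ᵇn
  ... | false = refl
  ... | true  = count-cong (upTo (suc (n ∸ d))) λ j j∈ →
    occursAt-map v u j (≤-trans (+-monoˡ-≤ d (s≤s⁻¹ (∈-upTo⁻ j∈))) (≤-reflexive (m∸n+n≡m d≤n)))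
    where
    d≤n : d ≤ n
    d≤n = ≤ᵇ⇒≤ d n (subst T (sym d≤ᵇn) _)

usesLettersBelow : {k n : ℕ} → ℕ → Vec (Fin k) n → Bool
usesLettersBelow zero    w = true
usesLettersBelow (suc j) w = usesLettersBelow j w ∧ not (avoids j w)

punchIn-≡ᵇ-below : {K : ℕ} (i : Fin (suc K)) (x : Fin K) (b : ℕ) → b < toℕ i →
  (toℕ (punchIn i x) ≡ᵇ b) ≡ (toℕ x ≡ᵇ b)
punchIn-≡ᵇ-below (Fin.suc i) Fin.zero     b       _   = refl
punchIn-≡ᵇ-below (Fin.suc i) (Fin.suc x) zero    _   = refl
punchIn-≡ᵇ-below (Fin.suc i) (Fin.suc x) (suc b) b<i = punchIn-≡ᵇ-below i x b (s<s⁻¹ b<i)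

avoids-map-punchIn : {K n : ℕ} (i : Fin (suc K)) (b : ℕ) → b < toℕ i → (w : Vec (Fin K) n) →
  avoids b (Vec.map (punchIn i) w) ≡ avoids b w
avoids-map-punchIn i b b<i []      = refl
avoids-map-punchIn i b b<i (x ∷ w) =
  cong₂ (λ e a → not e ∧ a) (punchIn-≡ᵇ-below i x b b<i) (avoids-map-punchIn i b b<i w)

usesLettersBelow-map-punchIn : {K n : ℕ} (i : Fin (suc K)) (j : ℕ) → j ≤ toℕ i → (w : Vec (Fin K) n) →
  usesLettersBelow j (Vec.map (punchIn i) w) ≡ usesLettersBelow j w
usesLettersBelow-map-punchIn i zero    _     w = refl
usesLettersBelow-map-punchIn i (suc j) j<i w =
  cong₂ (λ u a → u ∧ not a) (usesLettersBelow-map-punchIn i j (≤-trans (n≤1+n j) j<i) w)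
                           (avoids-map-punchIn i j j<i w)

module CountUsingLetters {n : ℕ} (P : {k : ℕ} → Vec (Fin k) n → Bool)
  (P-punchIn : {K : ℕ} (i : Fin (suc K)) (w : Vec (Fin K) n) → P (Vec.map (punchIn i) w) ≡ P w)
  where

  countUsing : ℕ → ℕ → ℕ
  countUsing j K = count (λ w → P w ∧ usesLettersBelow j w) (words K n)

  countUsing-suc : (j K : ℕ) → j ≤ K → countUsing j (suc K) ≡ countUsing (suc j) (suc K) + countUsing j K
  countUsing-suc j K j≤K = begin
    countUsing j (suc K)
      ≡⟨ count-split Pj (avoids j) W ⟩
    count (λ w → Pj w ∧ not (avoids j w)) W + count (λ w → Pj w ∧ avoids j w) W
      ≡⟨ cong₂ _+_ (count-cong W λ w _ → ∧-assoc (P w) _ _) (sym (count-filterᵇ Pj (avoids j) W)) ⟩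
    countUsing (suc j) (suc K) + count Pj (filterᵇ (avoids j) W)
      ≡⟨ cong (λ ws → countUsing (suc j) (suc K) + count Pj ws) avoiding ⟩
    countUsing (suc j) (suc K) + count Pj (map (Vec.map (punchIn i)) (words K n))
      ≡⟨ cong (λ m → countUsing (suc j) (suc K) + m) (count-map Pj (Vec.map (punchIn i)) (words K n)) ⟩
    countUsing (suc j) (suc K) + count (Pj ∘ Vec.map (punchIn i)) (words K n)
      ≡⟨ cong (λ m → countUsing (suc j) (suc K) + m) (count-cong (words K n) λ w _ →
           cong₂ _∧_ (P-punchIn i w) (usesLettersBelow-map-punchIn i j (≤-reflexive (sym toℕi≡j)) w)) ⟩
    countUsing (suc j) (suc K) + countUsing j K ∎
    where
    open ≡-Reasoning
    W : List (Vec (Fin (suc K)) n)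
    W = words (suc K) n
    Pj : {k : ℕ} → Vec (Fin k) n → Bool
    Pj w = P w ∧ usesLettersBelow j w
    i : Fin (suc K)
    i = fromℕ< (s≤s j≤K)
    toℕi≡j : toℕ i ≡ j
    toℕi≡j = toℕ-fromℕ< (s≤s j≤K)
    avoiding : filterᵇ (avoids j) W ≡ map (Vec.map (punchIn i)) (words K n)
    avoiding = subst (λ b → filterᵇ (avoids b) W ≡ map (Vec.map (punchIn i)) (words K n)) toℕi≡j
                     (words-avoiding K n i)

-- Forward differences

∑< : ℕ → (ℕ → ℤ) → ℤ
∑< zero    h = + 0
∑< (suc N) h = h 0 +ℤ ∑< N (h ∘ suc)

∑<-cong : (N : ℕ) {h h′ : ℕ → ℤ} → (∀ k → k < N → h k ≡ h′ k) → ∑< N h ≡ ∑< N h′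
∑<-cong zero    _    = refl
∑<-cong (suc N) h≗h′ =
  cong₂ _+ℤ_ (h≗h′ 0 (s≤s z≤n)) (∑<-cong N λ k k<N → h≗h′ (suc k) (s≤s k<N))

∑<-+ : (N : ℕ) (h h′ : ℕ → ℤ) → ∑< N (λ k → h k +ℤ h′ k) ≡ ∑< N h +ℤ ∑< N h′
∑<-+ zero    h h′ = refl
∑<-+ (suc N) h h′ = trans (cong (h 0 +ℤ h′ 0 +ℤ_) (∑<-+ N (h ∘ suc) (h′ ∘ suc)))
                          (interchange (h 0) (h′ 0) (∑< N (h ∘ suc)) (∑< N (h′ ∘ suc)))
  where
  interchange : ∀ a b c d → a +ℤ b +ℤ (c +ℤ d) ≡ a +ℤ c +ℤ (b +ℤ d)
  interchange = solve-∀

∑<-neg : (N : ℕ) (h : ℕ → ℤ) → ∑< N (λ k → - h k) ≡ - ∑< N h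
∑<-neg zero    h = refl
∑<-neg (suc N) h = trans (cong (- h 0 +ℤ_) (∑<-neg N (h ∘ suc))) (neg-+ (h 0) (∑< N (h ∘ suc)))
  where
  neg-+ : ∀ a b → - a +ℤ - b ≡ - (a +ℤ b)
  neg-+ = solve-∀

∑<-last : (N : ℕ) (h : ℕ → ℤ) → ∑< (suc N) h ≡ ∑< N h +ℤ h N
∑<-last zero    h = unit-comm (h 0)
  where
  unit-comm : ∀ a → a +ℤ + 0 ≡ + 0 +ℤ a
  unit-comm = solve-∀
∑<-last (suc N) h = trans (cong (h 0 +ℤ_) (∑<-last N (h ∘ suc))) (assoc (h 0) (∑< N (h ∘ suc)) (h (suc N)))
  where
  assoc : ∀ a b c → a +ℤ (b +ℤ c) ≡ a +ℤ b +ℤ c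
  assoc = solve-∀

sumFrom1≡∑< : (N : ℕ) (h : ℕ → ℤ) → sumFrom1 N h ≡ ∑< N (h ∘ suc)
sumFrom1≡∑< zero    h = refl
sumFrom1≡∑< (suc N) h = trans (cong (_+ℤ h (suc N)) (sumFrom1≡∑< N h)) (sym (∑<-last N (h ∘ suc)))

Δ : ℕ → (ℕ → ℤ) → ℤ
Δ j G = ∑< (suc j) (λ k → sign (j ∸ k) * + (j C k) * G k)

Δ-cong : (j : ℕ) {G G′ : ℕ → ℤ} → (∀ k → G k ≡ G′ k) → Δ j G ≡ Δ j G′
Δ-cong j G≗G′ = ∑<-cong (suc j) λ k _ → cong (sign (j ∸ k) * + (j C k) *_) (G≗G′ k)

Δ-suc : (j : ℕ) (G : ℕ → ℤ) → Δ (suc j) G ≡ Δ j (G ∘ suc) - Δ j G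
Δ-suc j G = begin
  Δ (suc j) G
    ≡⟨ cong (lead +ℤ_) (∑<-cong (suc j) λ k _ → pascal k) ⟩
  lead +ℤ ∑< (suc j) (λ k → shifted k +ℤ carry k)
    ≡⟨ cong (lead +ℤ_) (∑<-+ (suc j) shifted carry) ⟩
  lead +ℤ (Δ j (G ∘ suc) +ℤ ∑< (suc j) carry)
    ≡⟨ cong (λ c → lead +ℤ (Δ j (G ∘ suc) +ℤ c)) carry-sum ⟩
  lead +ℤ (Δ j (G ∘ suc) +ℤ (- ∑< j (term ∘ suc) +ℤ + 0))
    ≡⟨ rearrange (sign j) (G 0) (Δ j (G ∘ suc)) (∑< j (term ∘ suc)) ⟩
  Δ j (G ∘ suc) - Δ j G ∎
  where
  open ≡-Reasoning
  lead : ℤ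
  lead = - sign j * + 1 * G 0
  term shifted carry : ℕ → ℤ
  term    k = sign (j ∸ k) * + (j C k) * G k
  shifted k = sign (j ∸ k) * + (j C k) * G (suc k)
  carry   k = sign (j ∸ k) * + (j C suc k) * G (suc k)

  pascal : ∀ k → sign (suc j ∸ suc k) * + (suc j C suc k) * G (suc k) ≡ shifted k +ℤ carry k
  pascal k rewrite sym (nCk+nC[k+1]≡[n+1]C[k+1] j k) | pos-+ (j C k) (j C suc k) =
    distrib (sign (j ∸ k)) (+ (j C k)) (+ (j C suc k)) (G (suc k))
    where
    distrib : ∀ s a b x → s * (a +ℤ b) * x ≡ s * a * x +ℤ s * b * x
    distrib = solve-∀

  carry-below : ∀ k → k < j → carry k ≡ - term (suc k)
  carry-below k k<j rewrite +-∸-assoc 1 k<j =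
    neg-assoc (sign (j ∸ suc k)) (+ (j C suc k)) (G (suc k))
    where
    neg-assoc : ∀ s a x → - s * a * x ≡ - (s * a * x)
    neg-assoc = solve-∀

  carry-last : carry j ≡ + 0
  carry-last rewrite k>n⇒nCk≡0 (n<1+n j) = annihilate (sign (j ∸ j)) (G (suc j))
    where
    annihilate : ∀ s x → s * + 0 * x ≡ + 0
    annihilate = solve-∀

  carry-sum : ∑< (suc j) carry ≡ - ∑< j (term ∘ suc) +ℤ + 0
  carry-sum = begin
    ∑< (suc j) carry                      ≡⟨ ∑<-last j carry ⟩
    ∑< j carry +ℤ carry j                 ≡⟨ cong₂ _+ℤ_ (∑<-cong j carry-below) carry-last ⟩
    ∑< j (λ k → - term (suc k)) +ℤ + 0    ≡⟨ cong (_+ℤ + 0) (∑<-neg j (term ∘ suc)) ⟩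
    - ∑< j (term ∘ suc) +ℤ + 0            ∎

  rearrange : ∀ s x d r → - s * + 1 * x +ℤ (d +ℤ (- r +ℤ + 0)) ≡ d - (s * + 1 * x +ℤ r)
  rearrange = solve-∀

recurrence⇒Δ : (F : ℕ → ℕ → ℤ) → (∀ j K → j ≤ K → F j (suc K) ≡ F (suc j) (suc K) +ℤ F j K) →
  ∀ j m → F j (j + m) ≡ Δ j (λ k → F 0 (m + k))
recurrence⇒Δ F F-suc zero m = trans (cong (F 0) (sym (+-identityʳ m))) (unit (F 0 (m + 0)))
  where
  unit : ∀ x → x ≡ + 1 * + 1 * x +ℤ + 0
  unit = solve-∀
recurrence⇒Δ F F-suc (suc j) m = begin
  F (suc j) (suc (j + m))
    ≡⟨ solve-for (F-suc j (j + m) (m≤m+n j m)) ⟩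
  F j (suc (j + m)) - F j (j + m)
    ≡⟨ cong (λ K → F j K - F j (j + m)) (sym (+-suc j m)) ⟩
  F j (j + suc m) - F j (j + m)
    ≡⟨ cong₂ _-_ (recurrence⇒Δ F F-suc j (suc m)) (recurrence⇒Δ F F-suc j m) ⟩
  Δ j (λ k → F 0 (suc (m + k))) - Δ j G
    ≡⟨ cong (_- Δ j G) (Δ-cong j λ k → cong (F 0) (sym (+-suc m k))) ⟩
  Δ j (G ∘ suc) - Δ j G
    ≡⟨ sym (Δ-suc j G) ⟩
  Δ (suc j) G ∎
  where
  open ≡-Reasoning
  G : ℕ → ℤ
  G k = F 0 (m + k)
  solve-for : ∀ {a b c} → a ≡ b +ℤ c → b ≡ a - c
  solve-for {b = b} {c} refl = cancel b c
    where
    cancel : ∀ x y → x ≡ x +ℤ y - y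
    cancel = solve-∀

Δ≡sumFrom1 : (j : ℕ) (G : ℕ → ℤ) → G 0 ≡ + 0 →
  Δ j G ≡ sumFrom1 j (λ k → sign (j ∸ k) * + (j C k) * G k)
Δ≡sumFrom1 j G G0≡0 rewrite G0≡0 | sumFrom1≡∑< j (λ k → sign (j ∸ k) * + (j C k) * G k) =
  drop-lead (sign j) (∑< j (λ k → sign (j ∸ suc k) * + (j C suc k) * G (suc k)))
  where
  drop-lead : ∀ s x → s * + (j C 0) * + 0 +ℤ x ≡ x
  drop-lead = solve-∀

-- Permutations as words using every letter

T-isPermᵇ : {n : ℕ} (w : Vec (Fin n) n) → T (isPermᵇ w) ⇔ Injective _≡_ _≡_ (lookup w)
T-isPermᵇ {n} w = mk⇔ to from
  where
  agrees : Fin n → Fin n → Bool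
  agrees p q = (toℕ (lookup w p) ≡ᵇ toℕ (lookup w q)) ⇔ᵇ (toℕ p ≡ᵇ toℕ q)
  rowAgrees : Fin n → Bool
  rowAgrees p = allᵇ (agrees p)
  to : T (isPermᵇ w) → Injective _≡_ _≡_ (lookup w)
  to perm {p} {q} wp≡wq = toℕ-injective (≡ᵇ⇒≡ _ _ (subst T agree (≡⇒≡ᵇ _ _ (cong toℕ wp≡wq))))
    where
    agree : (toℕ (lookup w p) ≡ᵇ toℕ (lookup w q)) ≡ (toℕ p ≡ᵇ toℕ q)
    agree = Equivalence.to T-⇔ᵇ (Equivalence.to (T-allᵇ (agrees p)) (Equivalence.to (T-allᵇ rowAgrees) perm p) q)
  from : Injective _≡_ _≡_ (lookup w) → T (isPermᵇ w)
  from inj = Equivalence.from (T-allᵇ rowAgrees) λ p → Equivalence.from (T-allᵇ (agrees p)) λ q →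
    Equivalence.from T-⇔ᵇ (reflects-⇔ (≡ᵇ-reflects-≡ _ _) (≡ᵇ-reflects-≡ _ _)
      (mk⇔ (cong toℕ ∘ inj ∘ toℕ-injective) (cong (toℕ ∘ lookup w) ∘ toℕ-injective)))

T-not-avoids : {k n : ℕ} (b : ℕ) (w : Vec (Fin k) n) → T (not (avoids b w)) ⇔ ∃ λ p → toℕ (lookup w p) ≡ b
T-not-avoids b []      = mk⇔ (λ ()) (λ ())
T-not-avoids b (x ∷ w) with toℕ x ≡ᵇ b in x≡ᵇb
... | true  = mk⇔ (λ _ → Fin.zero , ≡ᵇ⇒≡ _ _ (subst T (sym x≡ᵇb) tt)) (λ _ → tt)
... | false = mk⇔ (Product.map Fin.suc id ∘ Equivalence.to (T-not-avoids b w))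
  λ { (Fin.zero  , x≡b) → ⊥-elim (subst T x≡ᵇb (≡⇒≡ᵇ _ _ x≡b))
    ; (Fin.suc p , e)   → Equivalence.from (T-not-avoids b w) (p , e) }

T-usesLettersBelow : {k n : ℕ} (j : ℕ) (w : Vec (Fin k) n) →
  T (usesLettersBelow j w) ⇔ (∀ b → b < j → ∃ λ p → toℕ (lookup w p) ≡ b)
T-usesLettersBelow zero    w = mk⇔ (λ _ b ()) (λ _ → tt)
T-usesLettersBelow (suc j) w = ⇔-trans T-∧ (mk⇔
  (λ (below , uses-j) b b<1+j → case-split below uses-j b (m<1+n⇒m<n∨m≡n b<1+j))
  (λ has → Equivalence.from (T-usesLettersBelow j w) (λ b b<j → has b (m<n⇒m<1+n b<j))
         , Equivalence.from (T-not-avoids j w) (has j (n<1+n j))))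
  where
  case-split : T (usesLettersBelow j w) → T (not (avoids j w)) → ∀ b → b < j ⊎ b ≡ j →
    ∃ λ p → toℕ (lookup w p) ≡ b
  case-split below _      b (inj₁ b<j) = Equivalence.to (T-usesLettersBelow j w) below b b<j
  case-split _     uses-j b (inj₂ refl) = Equivalence.to (T-not-avoids j w) uses-j

injective⇒strictlySurjective : {n : ℕ} (f : Fin n → Fin n) → Injective _≡_ _≡_ f → StrictlySurjective _≡_ f
injective⇒strictlySurjective {suc n} f inj y with f Fin.zero Fin.≟ y
... | yes f0≡y = Fin.zero , f0≡y
... | no  f0≢y = Product.map Fin.suc (punchOut-injective (f0≢f∘suc _) f0≢y)
                   (injective⇒strictlySurjective f′ f′-injective (punchOut f0≢y))
  where
  f0≢f∘suc : ∀ x → f Fin.zero ≢ f (Fin.suc x)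
  f0≢f∘suc x = 0≢1+n ∘ inj
  f′ : Fin n → Fin n
  f′ x = punchOut (f0≢f∘suc x)
  f′-injective : Injective _≡_ _≡_ f′
  f′-injective = suc-injective ∘ inj ∘ punchOut-injective (f0≢f∘suc _) (f0≢f∘suc _)

strictlySurjective⇒injective : {n : ℕ} (f : Fin n → Fin n) → StrictlySurjective _≡_ f → Injective _≡_ _≡_ f
strictlySurjective⇒injective f surj {x} {x′} fx≡fx′ =
  trans (sym (section∘f x)) (trans (cong section fx≡fx′) (section∘f x′))
  where
  section : Fin _ → Fin _
  section y = proj₁ (surj y)
  f∘section : ∀ y → f (section y) ≡ y
  f∘section y = proj₂ (surj y)
  section-injective : Injective _≡_ _≡_ section
  section-injective {y} {y′} s≡s = trans (sym (f∘section y)) (trans (cong f s≡s) (f∘section y′))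
  section∘f : ∀ x → section (f x) ≡ x
  section∘f x with y , sy≡x ← injective⇒strictlySurjective section section-injective x =
    trans (cong section (trans (cong f (sym sy≡x)) (f∘section y))) sy≡x

usesAllLetters≡isPermᵇ : {n : ℕ} (w : Vec (Fin n) n) → usesLettersBelow n w ≡ isPermᵇ w
usesAllLetters≡isPermᵇ {n} w = reflects-⇔ (T-reflects _) (T-reflects _)
  (⇔-trans (T-usesLettersBelow n w) (⇔-trans letters⇔onto (⇔-trans onto⇔injective (⇔-sym (T-isPermᵇ w)))))
  where
  letters⇔onto : (∀ b → b < n → ∃ λ p → toℕ (lookup w p) ≡ b) ⇔ StrictlySurjective _≡_ (lookup w)
  letters⇔onto = mk⇔
    (λ has y → Product.map₂ toℕ-injective (has (toℕ y) (toℕ<n y)))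
    (λ onto b b<n → Product.map₂ (λ wp≡ → trans (cong toℕ wp≡) (toℕ-fromℕ< b<n)) (onto (fromℕ< b<n)))
  onto⇔injective : StrictlySurjective _≡_ (lookup w) ⇔ Injective _≡_ _≡_ (lookup w)
  onto⇔injective = mk⇔ (strictlySurjective⇒injective (lookup w)) (injective⇒strictlySurjective (lookup w))

lemma4 : (d : ℕ) (v : Vec (Fin d) d) → IsPerm v →
    (n r : ℕ) → 1 ≤ n →
    + g r v (perms n) ≡ sumFrom1 n (λ k → sign (n ∸ k) * (+ (n C k)) * (+ g r v (words k n)))
lemma4 d v _ (suc n′) r _ = begin
  + count P (filterᵇ isPermᵇ (words n n))
    ≡⟨ cong +_ (count-filterᵇ P isPermᵇ (words n n)) ⟩
  + count (λ w → P w ∧ isPermᵇ w) (words n n)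
    ≡⟨ cong +_ (count-cong (words n n) λ w _ → cong (P w ∧_) (sym (usesAllLetters≡isPermᵇ w))) ⟩
  F n n
    ≡⟨ cong (F n) (sym (+-identityʳ n)) ⟩
  F n (n + 0)
    ≡⟨ recurrence⇒Δ F F-suc n 0 ⟩
  Δ n (F 0)
    ≡⟨ Δ-cong n (λ k → cong +_ (count-cong (words k n) λ w _ → ∧-identityʳ (P w))) ⟩
  Δ n G
    ≡⟨ Δ≡sumFrom1 n G refl ⟩
  sumFrom1 n (λ k → sign (n ∸ k) * (+ (n C k)) * (+ g r v (words k n))) ∎
  where
  open ≡-Reasoning
  n : ℕ
  n = suc n′
  P : {k : ℕ} → Vec (Fin k) n → Bool
  P w = con v w ≡ᵇ r
  open CountUsingLetters P (λ i w → cong (_≡ᵇ r) (con-map (punchIn-isOrderEmbedding i) v w))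
  F : ℕ → ℕ → ℤ
  F j K = + countUsing j K
  F-suc : ∀ j K → j ≤ K → F j (suc K) ≡ F (suc j) (suc K) +ℤ F j K
  F-suc j K j≤K = trans (cong +_ (countUsing-suc j K j≤K)) (pos-+ (countUsing (suc j) (suc K)) (countUsing j K))
  -- G 0 ≡ + 0 by computation: there is no word of positive length over the empty alphabet.
  G : ℕ → ℤ
  G k = + g r v (words k n)
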